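{- Let $G=(V,E)$ be a bispanning graph with $|V|\ge 3$. (i) If $G$ contains a pair of parallel edges, then $G$ is composite. (ii) Every atomic bispanning graph is simple. (iii) If $G$ has a cut-vertex (vertex-connectivity $1$), then $G$ is composite. (iv) If the edge-connectivity of $G$ equals $2$, then $G$ is composite. (v) If $G$ has a vertex of degree $2$, then $G$ is composite.
   Context: Graphs are finite, undirected, may have parallel edges, no loops. A graph is bispanning if its edge set is the disjoint union of two spanning trees. A bispanning graph is composite if it contains a subgraph which is itself bispanning, other than $G$ itself and the single-vertex graph $K_1$; otherwise it is atomic. A graph is simple if it has no parallel edges. -}

module Defs where

open import Data.Nat using (ℕ; _≤_; _<_)
open import Data.Fin using (Fin; _≟_)
open import Data.Fin.Subset using (Subset; _∈_; _∉_; ⊤; ⊥; ∁; _∩_; _∪_; ∣_∣; ⁅_⁆; inside; outside)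
open import Data.Vec using (tabulate)
open import Data.Bool using (_∨_; if_then_else_)
open import Data.Product using (Σ; ∃; _×_; _,_; proj₁; proj₂)
open import Data.Sum using (_⊎_)
open import Relation.Nullary using (¬_; does)
open import Relation.Binary.PropositionalEquality using (_≡_; _≢_)

record Graph : Set where
  field
    n        : ℕ
    m        : ℕ
    ends     : Fin m → Fin n × Fin n
    loopless : ∀ e → proj₁ (ends e) ≢ proj₂ (ends e)

module _ (G : Graph) where
  open Graph G

  Joins : Fin m → Fin n → Fin n → Set
  Joins e u v = ends e ≡ (u , v) ⊎ ends e ≡ (v , u)

  data Path (S : Subset m) : Fin n → Fin n → Set where
    here : ∀ {u} → Path S u u
    step : ∀ {u v w} (e : Fin m) → e ∈ S → Joins e u v → Path S v w → Path S u w

  ConnectedOn : Subset n → Subset m → Set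
  ConnectedOn W S = ∀ u v → u ∈ W → v ∈ W → Path S u v

  -- acyclic (forest): every edge of S is a bridge of S, i.e. its endpoints are
  -- not joined by a walk avoiding it (a multigraph has no cycle iff this holds)
  Acyclic : Subset m → Set
  Acyclic S = ∀ e → e ∈ S → ¬ Path (S ∩ ∁ ⁅ e ⁆) (proj₁ (ends e)) (proj₂ (ends e))

  IsSubgraph : Subset n → Subset m → Set
  IsSubgraph W F = ∀ e → e ∈ F → proj₁ (ends e) ∈ W × proj₂ (ends e) ∈ W

  SpanningTree : Subset n → Subset m → Subset m → Set
  SpanningTree W F T =
    (∀ e → e ∈ T → e ∈ F) × (∃ λ v → v ∈ W) × ConnectedOn W T × Acyclic T

  BispanningSub : Subset n → Subset m → Set
  BispanningSub W F = IsSubgraph W F ×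
    Σ (Subset m) λ T₁ → Σ (Subset m) λ T₂ →
      SpanningTree W F T₁ × SpanningTree W F T₂ × (T₁ ∩ T₂ ≡ ⊥) × (T₁ ∪ T₂ ≡ F)

  Bispanning : Set
  Bispanning = BispanningSub ⊤ ⊤

  -- composite: some bispanning subgraph other than G itself and K₁
  -- (at least 2 vertices excludes K₁, and the degenerate empty graph)
  Composite : Set
  Composite = Bispanning × Σ (Subset n) λ W → Σ (Subset m) λ F →
    BispanningSub W F × (2 ≤ ∣ W ∣) × (W ≢ ⊤ ⊎ F ≢ ⊤)

  Atomic : Set
  Atomic = Bispanning × ¬ Composite

  HasParallelEdges : Set
  HasParallelEdges = Σ (Fin m) λ e → Σ (Fin m) λ f →
    e ≢ f × Joins f (proj₁ (ends e)) (proj₂ (ends e))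

  Simple : Set
  Simple = ¬ HasParallelEdges

  incident : Fin n → Subset m
  incident v = tabulate λ e →
    if does (v ≟ proj₁ (ends e)) ∨ does (v ≟ proj₂ (ends e)) then inside else outside

  degree : Fin n → ℕ
  degree v = ∣ incident v ∣

  CutVertex : Fin n → Set
  CutVertex v = Σ (Fin n) λ u → Σ (Fin n) λ w →
    u ≢ v × w ≢ v × ¬ Path (∁ (incident v)) u w

  HasCutVertex : Set
  HasCutVertex = ∃ CutVertex

  Disconnects : Subset m → Set
  Disconnects S = Σ (Fin n) λ u → Σ (Fin n) λ w → ¬ Path (∁ S) u w

  EdgeConnectivity : ℕ → Set
  EdgeConnectivity k = (Σ (Subset m) λ S → ∣ S ∣ ≡ k × Disconnects S)
                     × (∀ S → ∣ S ∣ < k → ¬ Disconnects S)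

-- A bispanning graph G = T₁ ⊎ T₂ is composite as soon as some vertex set W with
-- 2 ≤ |W| < |V| is left by each Tᵢ through a single vertex of W: a walk of Tᵢ
-- between two vertices of W can then only leave W and come back at that vertex,
-- so Tᵢ restricted to the edges inside W still spans W, and the subgraph induced
-- by W is bispanning.
--  (iii) For a cut-vertex v, W = v plus a component of G − v is left only at v.
--  (iv)  For a 2-edge cut S, each spanning tree crosses S and the trees are
--        disjoint, so each crosses S exactly once; a side with at least two
--        vertices serves as W, and one exists since |V| ≥ 3.
--  (v)   The two edges at a vertex v of degree 2 form such a cut, with W = V − v.
--  (i)   Parallel edges lie in different trees (a tree has no 2-cycle), so each
--        tree spans their two ends W by one of them.  (ii) is the contrapositive.

module Submission where

open import Defs
open import Data.Nat using (ℕ; zero; suc; _+_; _∸_; _≤_; _<_; s≤s; z≤n; _≤?_)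
open import Data.Nat.Properties
  using (≤-trans; ≤-reflexive; ≤-refl; <-≤-trans; ≤-<-trans; <-trans; <-irrefl; +-suc; +-monoʳ-≤; n≤1+n;
         ∸-mono; ≰⇒>; ≤-pred; module ≤-Reasoning)
open import Data.Fin using (Fin)
open import Data.Fin.Properties using (_≟_; any?)
open import Data.Fin.Subset
  using (Subset; _∈_; _∉_; _⊆_; ⊤; ⊥; ∁; _∩_; _∪_; ∣_∣; ⁅_⁆; inside; outside; Nonempty)
open import Data.Fin.Subset.Properties
  using (_∈?_; ∈⊤; ∉⊥; x∈⁅x⁆; x∈⁅y⁆⇒x≡y; x≢y⇒x∉⁅y⁆; ∣⁅x⁆∣≡1; ∣⊤∣≡n; ∣⊥∣≡0; ∣p∣≤n; ∣∁p∣≡n∸∣p∣;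
         x∈p⇒∣p-x∣<∣p∣; x∈p∧x≢y⇒x∈p-y; p⊂q⇒∣p∣<∣q∣; ⊆-antisym; nonempty?; Empty-unique;
         x∈p⇒x∉∁p; x∈∁p⇒x∉p; x∉∁p⇒x∈p; x∉p⇒x∈∁p; x∈p∩q⁺; x∈p∩q⁻; p∩q⊆p; p∩q⊆q; x∈p∪q⁺; x∈p∪q⁻;
         p⊆p∪q; q⊆p∪q; ∩-comm; ∪-comm; ∩-distribʳ-∪; ∩-identityˡ)
open import Data.Vec using (_∷_; []; tabulate)
open import Data.Vec.Properties using (lookup∘tabulate; lookup⇒[]=; []=⇒lookup; tabulate-cong)
open import Data.Bool using (true; false; if_then_else_)
open import Data.Product using (∃; _×_; _,_; proj₁; proj₂)
import Data.Product.Properties as Product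
open import Data.Sum using (_⊎_; inj₁; inj₂)
import Data.Sum as Sum
open import Function using (_∘_)
open import Relation.Nullary using (Dec; yes; no; does; contradiction)
open import Relation.Nullary.Decidable using (_×-dec_; _⊎-dec_; ¬?; dec-true; decidable-stable)
open import Relation.Unary using (Decidable)
open import Relation.Binary.PropositionalEquality
  using (_≡_; _≢_; refl; sym; trans; cong; cong₂; subst; module ≡-Reasoning)

∣p∪q∣≤∣p∣+∣q∣ : ∀ {k} (p q : Subset k) → ∣ p ∪ q ∣ ≤ ∣ p ∣ + ∣ q ∣
∣p∪q∣≤∣p∣+∣q∣ []            []            = z≤n
∣p∪q∣≤∣p∣+∣q∣ (outside ∷ p) (outside ∷ q) = ∣p∪q∣≤∣p∣+∣q∣ p q
∣p∪q∣≤∣p∣+∣q∣ (outside ∷ p) (inside  ∷ q) =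
  ≤-trans (s≤s (∣p∪q∣≤∣p∣+∣q∣ p q)) (≤-reflexive (sym (+-suc ∣ p ∣ ∣ q ∣)))
∣p∪q∣≤∣p∣+∣q∣ (inside  ∷ p) (outside ∷ q) = s≤s (∣p∪q∣≤∣p∣+∣q∣ p q)
∣p∪q∣≤∣p∣+∣q∣ (inside  ∷ p) (inside  ∷ q) =
  s≤s (≤-trans (∣p∪q∣≤∣p∣+∣q∣ p q) (+-monoʳ-≤ ∣ p ∣ (n≤1+n ∣ q ∣)))

module _ {k : ℕ} where

  select : {P : Fin k → Set} → Decidable P → Subset k
  select P? = tabulate (does ∘ P?)

  x∈select⁺ : {P : Fin k → Set} (P? : Decidable P) {x : Fin k} → P x → x ∈ select P?
  x∈select⁺ P? {x} px =
    lookup⇒[]= x (select P?) (trans (lookup∘tabulate (does ∘ P?) x) (dec-true (P? x) px))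

  x∈select⁻ : {P : Fin k → Set} (P? : Decidable P) {x : Fin k} → x ∈ select P? → P x
  x∈select⁻ P? {x} x∈ with P? x | trans (sym (lookup∘tabulate (does ∘ P?) x)) ([]=⇒lookup x∈)
  ... | yes px | _  = px
  ... | no _   | ()

  ∪≡⊤⇒∈ : {p q : Subset k} {x : Fin k} → p ∪ q ≡ ⊤ → x ∉ p → x ∈ q
  ∪≡⊤⇒∈ {p} {q} {x} p∪q≡⊤ x∉p with x∈p∪q⁻ p q (subst (x ∈_) (sym p∪q≡⊤) ∈⊤)
  ... | inj₁ x∈p = contradiction x∈p x∉p
  ... | inj₂ x∈q = x∈q

  ∩≡⊥⇒∉ : {p q : Subset k} {x : Fin k} → p ∩ q ≡ ⊥ → x ∈ p → x ∉ q
  ∩≡⊥⇒∉ {x = x} p∩q≡⊥ x∈p x∈q = ∉⊥ (subst (x ∈_) p∩q≡⊥ (x∈p∩q⁺ (x∈p , x∈q)))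

  x∉p⇒p≢⊤ : {p : Subset k} {x : Fin k} → x ∉ p → p ≢ ⊤
  x∉p⇒p≢⊤ {x = x} x∉p p≡⊤ = x∉p (subst (x ∈_) (sym p≡⊤) ∈⊤)

  x∈p⇒0<∣p∣ : {p : Subset k} {x : Fin k} → x ∈ p → 0 < ∣ p ∣
  x∈p⇒0<∣p∣ {p} x∈p = ≤-<-trans z≤n (x∈p⇒∣p-x∣<∣p∣ {p = p} x∈p)

  x≢y⇒1<∣p∣ : {p : Subset k} {x y : Fin k} → x ∈ p → y ∈ p → x ≢ y → 1 < ∣ p ∣
  x≢y⇒1<∣p∣ {p} x∈p y∈p x≢y =
    <-≤-trans (s≤s (x∈p⇒0<∣p∣ (x∈p∧x≢y⇒x∈p-y y∈p (x≢y ∘ sym)))) (x∈p⇒∣p-x∣<∣p∣ {p = p} x∈p)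

  x≢y≢z⇒2<∣p∣ : {p : Subset k} {x y z : Fin k} → x ∈ p → y ∈ p → z ∈ p →
                x ≢ y → x ≢ z → y ≢ z → 2 < ∣ p ∣
  x≢y≢z⇒2<∣p∣ {p} x∈p y∈p z∈p x≢y x≢z y≢z =
    <-≤-trans (s≤s (x≢y⇒1<∣p∣ (x∈p∧x≢y⇒x∈p-y y∈p (x≢y ∘ sym)) (x∈p∧x≢y⇒x∈p-y z∈p (x≢z ∘ sym)) y≢z))
              (x∈p⇒∣p-x∣<∣p∣ {p = p} x∈p)

  ∣p∣≡2⇒pigeonhole : {p : Subset k} {x y z : Fin k} → ∣ p ∣ ≡ 2 →
                     x ∈ p → y ∈ p → z ∈ p → x ≢ z → y ≢ z → x ≡ y
  ∣p∣≡2⇒pigeonhole {x = x} {y} ∣p∣≡2 x∈p y∈p z∈p x≢z y≢z with x ≟ y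
  ... | yes x≡y = x≡y
  ... | no x≢y =
    contradiction (subst (2 <_) ∣p∣≡2 (x≢y≢z⇒2<∣p∣ x∈p y∈p z∈p x≢y x≢z y≢z)) (<-irrefl refl)

  0<∣p∣⇒Nonempty : (p : Subset k) → 0 < ∣ p ∣ → Nonempty p
  0<∣p∣⇒Nonempty p 0<∣p∣ with nonempty? p
  ... | yes nonempty = nonempty
  ... | no empty =
    contradiction (subst (0 <_) (trans (cong ∣_∣ (Empty-unique empty)) (∣⊥∣≡0 k)) 0<∣p∣) (<-irrefl refl)

module _ (G : Graph) where
  open Graph G

  joins-sym : ∀ {e u v} → Joins G e u v → Joins G e v u
  joins-sym = Sum.swap

  joins? : ∀ e u v → Dec (Joins G e u v)
  joins? e u v = Product.≡-dec _≟_ _≟_ (ends e) (u , v) ⊎-dec Product.≡-dec _≟_ _≟_ (ends e) (v , u)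

  _++ᵖ_ : ∀ {S x y z} → Path G S x y → Path G S y z → Path G S x z
  here              ++ᵖ walk′ = walk′
  step e e∈S j walk ++ᵖ walk′ = step e e∈S j (walk ++ᵖ walk′)

  Path-mono : ∀ {S S′ x y} → S ⊆ S′ → Path G S x y → Path G S′ x y
  Path-mono S⊆S′ here                = here
  Path-mono S⊆S′ (step e e∈S j walk) = step e (S⊆S′ e∈S) j (Path-mono S⊆S′ walk)

  inner? : ∀ W → Decidable λ e → proj₁ (ends e) ∈ W × proj₂ (ends e) ∈ W
  inner? W e = proj₁ (ends e) ∈? W ×-dec proj₂ (ends e) ∈? W

  inner : Subset n → Subset m
  inner W = select (inner? W)

  joins⇒inner : ∀ {W e x z} → Joins G e x z → x ∈ W → z ∈ W → e ∈ inner W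
  joins⇒inner {W} {e} (inj₁ ends≡) x∈W z∈W =
    x∈select⁺ (inner? W) ( subst (_∈ W) (sym (cong proj₁ ends≡)) x∈W
                         , subst (_∈ W) (sym (cong proj₂ ends≡)) z∈W)
  joins⇒inner (inj₂ ends≡) x∈W z∈W = joins⇒inner (inj₁ ends≡) z∈W x∈W

  incident? : ∀ v → Decidable λ e → v ≡ proj₁ (ends e) ⊎ v ≡ proj₂ (ends e)
  incident? v e = v ≟ proj₁ (ends e) ⊎-dec v ≟ proj₂ (ends e)

  incident≡select : ∀ v → incident G v ≡ select (incident? v)
  incident≡select v = tabulate-cong λ e → if-bool _
    where
    if-bool : ∀ b → (if b then inside else outside) ≡ b
    if-bool true  = refl
    if-bool false = refl

  incident⇒end : ∀ {v e x z} → e ∈ incident G v → Joins G e x z → v ≡ x ⊎ v ≡ z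
  incident⇒end {v} {e} e∈ j with x∈select⁻ (incident? v) (subst (e ∈_) (incident≡select v) e∈) | j
  ... | inj₁ v≡₁ | inj₁ ends≡ = inj₁ (trans v≡₁ (cong proj₁ ends≡))
  ... | inj₂ v≡₂ | inj₁ ends≡ = inj₂ (trans v≡₂ (cong proj₂ ends≡))
  ... | inj₁ v≡₁ | inj₂ ends≡ = inj₂ (trans v≡₁ (cong proj₁ ends≡))
  ... | inj₂ v≡₂ | inj₂ ends≡ = inj₁ (trans v≡₂ (cong proj₂ ends≡))

  joins⇒incident : ∀ {e x z} → Joins G e x z → e ∈ incident G z
  joins⇒incident {e} {z = z} j = subst (e ∈_) (sym (incident≡select z)) (x∈select⁺ (incident? z) (end j))
    where
    end : Joins G e _ z → z ≡ proj₁ (ends e) ⊎ z ≡ proj₂ (ends e)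
    end (inj₁ ends≡) = inj₂ (sym (cong proj₂ ends≡))
    end (inj₂ ends≡) = inj₁ (sym (cong proj₁ ends≡))

  module Reachable (S : Subset m) (u : Fin n) where

    Adjacent : Subset n → Fin n → Set
    Adjacent R y = ∃ λ e → e ∈ S × ∃ λ x → x ∈ R × Joins G e x y

    adjacent? : ∀ R → Decidable (Adjacent R)
    adjacent? R y = any? λ e → e ∈? S ×-dec any? λ x → x ∈? R ×-dec joins? e x y

    expand : Subset n → Subset n
    expand R = R ∪ select (adjacent? R)

    closed-or-grows : ∀ R → expand R ⊆ R ⊎ ∣ R ∣ < ∣ expand R ∣
    closed-or-grows R with any? (λ x → x ∈? expand R ×-dec ¬? (x ∈? R))
    ... | yes (x , x∈ , x∉) = inj₂ (p⊂q⇒∣p∣<∣q∣ (p⊆p∪q _ , x , x∈ , x∉))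
    ... | no none           = inj₁ λ {x} x∈ → decidable-stable (x ∈? R) λ x∉ → none (x , x∈ , x∉)

    closed-expand : ∀ {R} → expand R ⊆ R → expand (expand R) ⊆ expand R
    closed-expand {R} closed = subst (λ Q → expand Q ⊆ Q) (⊆-antisym (p⊆p∪q _) closed) closed

    iterate : ℕ → Subset n
    iterate zero    = ⁅ u ⁆
    iterate (suc k) = expand (iterate k)

    closed-or-large : ∀ k → expand (iterate k) ⊆ iterate k ⊎ k < ∣ iterate k ∣
    closed-or-large zero = inj₂ (x∈p⇒0<∣p∣ (x∈⁅x⁆ u))
    closed-or-large (suc k) with closed-or-grows (iterate k) | closed-or-large k
    ... | inj₁ closed | _           = inj₁ (closed-expand closed)
    ... | inj₂ _      | inj₁ closed = inj₁ (closed-expand closed)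
    ... | inj₂ grows  | inj₂ large  = inj₂ (<-≤-trans (s≤s large) grows)

    reach : Subset n
    reach = iterate n

    expand-reach⊆reach : expand reach ⊆ reach
    expand-reach⊆reach with closed-or-large n
    ... | inj₁ closed = closed
    ... | inj₂ large  = contradiction (<-≤-trans large (∣p∣≤n reach)) (<-irrefl refl)

    u∈reach : u ∈ reach
    u∈reach = u∈iterate n
      where
      u∈iterate : ∀ k → u ∈ iterate k
      u∈iterate zero    = x∈⁅x⁆ u
      u∈iterate (suc k) = p⊆p∪q _ (u∈iterate k)

    reach-sound : ∀ {x} → x ∈ reach → Path G S u x
    reach-sound = sound n
      where
      sound : ∀ k {y} → y ∈ iterate k → Path G S u y
      sound zero y∈ rewrite x∈⁅y⁆⇒x≡y u y∈ = here
      sound (suc k) y∈ with x∈p∪q⁻ (iterate k) _ y∈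
      ... | inj₁ y∈R = sound k y∈R
      ... | inj₂ y∈A with x∈select⁻ (adjacent? (iterate k)) y∈A
      ...   | e , e∈S , x , x∈R , j = sound k x∈R ++ᵖ step e e∈S j here

    reach-closed : ∀ {e x y} → x ∈ reach → e ∈ S → Joins G e x y → y ∈ reach
    reach-closed x∈ e∈S j =
      expand-reach⊆reach (q⊆p∪q reach _ (x∈select⁺ (adjacent? reach) (_ , e∈S , _ , x∈ , j)))

  Leaves : Fin m → Subset n → Fin n → Set
  Leaves e W x = x ∈ W × ∃ λ z → Joins G e x z × z ∉ W

  leaves-unique : ∀ {e W x x′} → Leaves e W x → Leaves e W x′ → x ≡ x′
  leaves-unique (_ , _ , inj₁ p , _) (_ , _ , inj₁ q , _) = cong proj₁ (trans (sym p) q)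
  leaves-unique {W = W} (x∈W , _ , inj₁ p , _) (_ , _ , inj₂ q , z′∉W) =
    contradiction (subst (_∈ W) (cong proj₁ (trans (sym p) q)) x∈W) z′∉W
  leaves-unique {W = W} (_ , _ , inj₂ p , z∉W) (x′∈W , _ , inj₁ q , _) =
    contradiction (subst (_∈ W) (cong proj₁ (trans (sym q) p)) x′∈W) z∉W
  leaves-unique (_ , _ , inj₂ p , _) (_ , _ , inj₂ q , _) = cong proj₂ (trans (sym p) q)

  leaves-∁ : ∀ {e W x} → Leaves e (∁ W) x → ∃ (Leaves e W)
  leaves-∁ {x = x} (x∈∁W , z , j , z∉∁W) = _ , x∉∁p⇒x∈p z∉∁W , x , joins-sym j , x∈∁p⇒x∉p x∈∁W

  leaving-edge : ∀ {T W x y} → Path G T x y → x ∈ W → y ∉ W → ∃ λ e → e ∈ T × ∃ (Leaves e W)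
  leaving-edge here x∈W x∉W = contradiction x∈W x∉W
  leaving-edge {W = W} (step {v = z} e e∈T j walk) x∈W y∉W with z ∈? W
  ... | yes z∈W = leaving-edge walk z∈W y∉W
  ... | no z∉W  = e , e∈T , _ , x∈W , z , j , z∉W

  ExitsOnlyAt : Subset m → Subset n → Fin n → Set
  ExitsOnlyAt T W p = ∀ {e x} → e ∈ T → Leaves e W x → x ≡ p

  -- A walk into W that meets the outside of W can be shortcut at p.
  restrict-walk : ∀ {T W p x y} → ExitsOnlyAt T W p → Path G T x y → y ∈ W →
    (x ∈ W → Path G (T ∩ inner W) x y) × (x ∉ W → Path G (T ∩ inner W) p y)
  restrict-walk exits here y∈W = (λ _ → here) , (λ y∉W → contradiction y∈W y∉W)
  restrict-walk {T} {W} exits (step {v = z} e e∈T j walk) y∈W with restrict-walk exits walk y∈W | z ∈? W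
  ... | from-z , _ | yes z∈W =
      (λ x∈W → step e (x∈p∩q⁺ (e∈T , joins⇒inner j x∈W z∈W)) j (from-z z∈W))
    , (λ x∉W → subst (λ q → Path G (T ∩ inner W) q _) (exits e∈T (z∈W , _ , joins-sym j , x∉W)) (from-z z∈W))
  ... | _ , from-p | no z∉W =
      (λ x∈W → subst (λ q → Path G (T ∩ inner W) q _) (sym (exits e∈T (x∈W , z , j , z∉W))) (from-p z∉W))
    , (λ _ → from-p z∉W)

  SpanningTreeᴳ : Subset m → Set
  SpanningTreeᴳ = SpanningTree G ⊤ ⊤

  inner-connected : ∀ {T W p} → SpanningTreeᴳ T → ExitsOnlyAt T W p → ConnectedOn G W (T ∩ inner W)
  inner-connected (_ , _ , connected , _) exits x y x∈W y∈W =
    proj₁ (restrict-walk exits (connected x y ∈⊤ ∈⊤) y∈W) x∈W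

  inner-spanningTree : ∀ {T W p} → SpanningTreeᴳ T → p ∈ W → ConnectedOn G W (T ∩ inner W) →
                       SpanningTree G W (inner W) (T ∩ inner W)
  inner-spanningTree {T} {W} (_ , _ , _ , acyclic) p∈W connected =
    (λ _ → p∩q⊆q T (inner W)) , (_ , p∈W) , connected ,
    λ e e∈ cycle → acyclic e (p∩q⊆p T (inner W) e∈) (Path-mono (drop-inner e) cycle)
    where
    drop-inner : ∀ e → (T ∩ inner W) ∩ ∁ ⁅ e ⁆ ⊆ T ∩ ∁ ⁅ e ⁆
    drop-inner e f∈ with x∈p∩q⁻ (T ∩ inner W) _ f∈
    ... | f∈T∩W , f∉e = x∈p∩q⁺ (p∩q⊆p T (inner W) f∈T∩W , f∉e)

  SpanningTreePair : Subset m → Subset m → Set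
  SpanningTreePair T₁ T₂ = SpanningTreeᴳ T₁ × SpanningTreeᴳ T₂ × (T₁ ∩ T₂ ≡ ⊥) × (T₁ ∪ T₂ ≡ ⊤)

  SpanningTreePair-swap : ∀ {T₁ T₂} → SpanningTreePair T₁ T₂ → SpanningTreePair T₂ T₁
  SpanningTreePair-swap {T₁} {T₂} (st₁ , st₂ , disjoint , cover) =
    st₂ , st₁ , trans (∩-comm T₂ T₁) disjoint , trans (∪-comm T₂ T₁) cover

  inner-bispanning : ∀ {T₁ T₂ W p} → SpanningTreePair T₁ T₂ → p ∈ W →
    ConnectedOn G W (T₁ ∩ inner W) → ConnectedOn G W (T₂ ∩ inner W) → BispanningSub G W (inner W)
  inner-bispanning {T₁} {T₂} {W} (st₁ , st₂ , disjoint , cover) p∈W connected₁ connected₂ =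
    (λ _ → x∈select⁻ (inner? W)) , T₁ ∩ inner W , T₂ ∩ inner W ,
    inner-spanningTree st₁ p∈W connected₁ , inner-spanningTree st₂ p∈W connected₂ ,
    Empty-unique (λ (e , e∈) → ∩≡⊥⇒∉ disjoint (p∩q⊆p T₁ _ (p∩q⊆p _ _ e∈)) (p∩q⊆p T₂ _ (p∩q⊆q _ _ e∈))) ,
    partition
    where
    open ≡-Reasoning
    partition : (T₁ ∩ inner W) ∪ (T₂ ∩ inner W) ≡ inner W
    partition = begin
      (T₁ ∩ inner W) ∪ (T₂ ∩ inner W) ≡⟨ sym (∩-distribʳ-∪ (inner W) T₁ T₂) ⟩
      (T₁ ∪ T₂) ∩ inner W             ≡⟨ cong (_∩ inner W) cover ⟩
      ⊤ ∩ inner W                     ≡⟨ ∩-identityˡ (inner W) ⟩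
      inner W                         ∎

  parallel-edge-in-tree : ∀ {T₁ T₂ e f} → SpanningTreePair T₁ T₂ → e ≢ f →
    Joins G f (proj₁ (ends e)) (proj₂ (ends e)) → e ∈ T₁ ⊎ f ∈ T₁
  parallel-edge-in-tree {T₁} {e = e} {f} (_ , (_ , _ , _ , acyclic₂) , _ , cover) e≢f f∥e
    with e ∈? T₁ | f ∈? T₁
  ... | yes e∈T₁ | _        = inj₁ e∈T₁
  ... | no _     | yes f∈T₁ = inj₂ f∈T₁
  ... | no e∉T₁  | no f∉T₁  =
    contradiction (step f (x∈p∩q⁺ (∪≡⊤⇒∈ cover f∉T₁ , x∉p⇒x∈∁p (x≢y⇒x∉⁅y⁆ (e≢f ∘ sym)))) f∥e here)
                  (acyclic₂ e (∪≡⊤⇒∈ cover e∉T₁))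

  edge-connects-pair : ∀ {T g u v} → g ∈ T → Joins G g u v →
    ConnectedOn G (⁅ u ⁆ ∪ ⁅ v ⁆) (T ∩ inner (⁅ u ⁆ ∪ ⁅ v ⁆))
  edge-connects-pair {T} {g} {u} {v} g∈T j = connect
    where
    in-pair : ∀ {x} → x ∈ ⁅ u ⁆ ∪ ⁅ v ⁆ → x ≡ u ⊎ x ≡ v
    in-pair = Sum.map (x∈⁅y⁆⇒x≡y u) (x∈⁅y⁆⇒x≡y v) ∘ x∈p∪q⁻ _ _
    g∈ : g ∈ T ∩ inner (⁅ u ⁆ ∪ ⁅ v ⁆)
    g∈ = x∈p∩q⁺ (g∈T , joins⇒inner j (x∈p∪q⁺ (inj₁ (x∈⁅x⁆ u))) (x∈p∪q⁺ (inj₂ (x∈⁅x⁆ v))))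
    connect : ConnectedOn G (⁅ u ⁆ ∪ ⁅ v ⁆) (T ∩ inner (⁅ u ⁆ ∪ ⁅ v ⁆))
    connect x y x∈W y∈W with in-pair x∈W | in-pair y∈W
    ... | inj₁ refl | inj₁ refl = here
    ... | inj₂ refl | inj₂ refl = here
    ... | inj₁ refl | inj₂ refl = step g g∈ j here
    ... | inj₂ refl | inj₁ refl = step g g∈ (joins-sym j) here

  exits-once : ∀ {T T′ W S a b} → SpanningTreeᴳ T → SpanningTreeᴳ T′ → (∀ {e} → e ∈ T → e ∉ T′) →
    ∣ S ∣ ≡ 2 → (∀ {e x} → Leaves e W x → e ∈ S) → a ∈ W → b ∉ W → ∃ (ExitsOnlyAt T W)
  exits-once (_ , _ , connected , _) (_ , _ , connected′ , _) disjoint ∣S∣≡2 cut a∈W b∉W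
    with leaving-edge (connected _ _ ∈⊤ ∈⊤) a∈W b∉W | leaving-edge (connected′ _ _ ∈⊤ ∈⊤) a∈W b∉W
  ... | e₁ , e₁∈T , x₁ , leaves₁ | e₂ , e₂∈T′ , _ , leaves₂ = x₁ , exits
    where
    exits : ExitsOnlyAt _ _ x₁
    exits e∈T leaves with ∣p∣≡2⇒pigeonhole ∣S∣≡2 (cut leaves) (cut leaves₁) (cut leaves₂)
                            (λ { refl → disjoint e∈T e₂∈T′ }) (λ { refl → disjoint e₁∈T e₂∈T′ })
    ... | refl = leaves-unique leaves leaves₁

  two-edge-cut-bispanning : ∀ {T₁ T₂ W S a b} → SpanningTreePair T₁ T₂ → ∣ S ∣ ≡ 2 →
    (∀ {e x} → Leaves e W x → e ∈ S) → a ∈ W → b ∉ W → BispanningSub G W (inner W)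
  two-edge-cut-bispanning pair@(st₁ , st₂ , disjoint , _) ∣S∣≡2 cut a∈W b∉W =
    inner-bispanning pair a∈W (inner-connected st₁ (proj₂ (exits-once st₁ st₂ T₁∌T₂ ∣S∣≡2 cut a∈W b∉W)))
                              (inner-connected st₂ (proj₂ (exits-once st₂ st₁ T₂∌T₁ ∣S∣≡2 cut a∈W b∉W)))
    where
    T₁∌T₂ : ∀ {e} → e ∈ _ → e ∉ _
    T₁∌T₂ = ∩≡⊥⇒∉ disjoint
    T₂∌T₁ : ∀ {e} → e ∈ _ → e ∉ _
    T₂∌T₁ e∈T₂ e∈T₁ = ∩≡⊥⇒∉ disjoint e∈T₁ e∈T₂

  two-edge-cut⇒composite : ∀ {W S a b} → Bispanning G → ∣ S ∣ ≡ 2 →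
    (∀ {e x} → Leaves e W x → e ∈ S) → a ∈ W → b ∉ W → 2 ≤ ∣ W ∣ → Composite G
  two-edge-cut⇒composite B@(_ , _ , _ , pair) ∣S∣≡2 cut a∈W b∉W 2≤∣W∣ =
    B , _ , _ , two-edge-cut-bispanning pair ∣S∣≡2 cut a∈W b∉W , 2≤∣W∣ , inj₁ (x∉p⇒p≢⊤ b∉W)

  parallel-edges⇒composite : Bispanning G → 3 ≤ n → HasParallelEdges G → Composite G
  parallel-edges⇒composite B@(_ , _ , _ , pair) 3≤n (e , f , e≢f , f∥e) =
    B , W , inner W , inner-bispanning pair u∈W (contains-edge pair) (contains-edge (SpanningTreePair-swap pair)) ,
    x≢y⇒1<∣p∣ u∈W v∈W (loopless e) , inj₁ W≢⊤
    where
    u = proj₁ (ends e)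
    v = proj₂ (ends e)
    W = ⁅ u ⁆ ∪ ⁅ v ⁆
    u∈W : u ∈ W
    u∈W = x∈p∪q⁺ (inj₁ (x∈⁅x⁆ u))
    v∈W : v ∈ W
    v∈W = x∈p∪q⁺ (inj₂ (x∈⁅x⁆ v))
    contains-edge : ∀ {T T′} → SpanningTreePair T T′ → ConnectedOn G W (T ∩ inner W)
    contains-edge pair′ with parallel-edge-in-tree pair′ e≢f f∥e
    ... | inj₁ e∈T = edge-connects-pair e∈T (inj₁ refl)
    ... | inj₂ f∈T = edge-connects-pair f∈T f∥e
    W≢⊤ : W ≢ ⊤
    W≢⊤ W≡⊤ = <-irrefl refl (≤-trans 3≤n (begin
      n                     ≡⟨ sym (∣⊤∣≡n n) ⟩
      ∣ ⊤ {n} ∣             ≡⟨ cong ∣_∣ (sym W≡⊤) ⟩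
      ∣ W ∣                 ≤⟨ ∣p∪q∣≤∣p∣+∣q∣ ⁅ u ⁆ ⁅ v ⁆ ⟩
      ∣ ⁅ u ⁆ ∣ + ∣ ⁅ v ⁆ ∣ ≡⟨ cong₂ _+_ (∣⁅x⁆∣≡1 u) (∣⁅x⁆∣≡1 v) ⟩
      2                     ∎))
      where open ≤-Reasoning

  cut-vertex⇒composite : Bispanning G → HasCutVertex G → Composite G
  cut-vertex⇒composite B@(_ , _ , _ , pair@(st₁ , st₂ , _)) (v , u , w , u≢v , w≢v , no-walk) =
    B , W , inner W , inner-bispanning pair v∈W (inner-connected st₁ exits) (inner-connected st₂ exits) ,
    x≢y⇒1<∣p∣ u∈W v∈W u≢v , inj₁ (x∉p⇒p≢⊤ w∉W)
    where
    open Reachable (∁ (incident G v)) u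
    W = reach ∪ ⁅ v ⁆
    u∈W : u ∈ W
    u∈W = x∈p∪q⁺ (inj₁ u∈reach)
    v∈W : v ∈ W
    v∈W = x∈p∪q⁺ (inj₂ (x∈⁅x⁆ v))
    w∉W : w ∉ W
    w∉W w∈W with x∈p∪q⁻ reach ⁅ v ⁆ w∈W
    ... | inj₁ w∈reach = no-walk (reach-sound w∈reach)
    ... | inj₂ w∈v     = w≢v (x∈⁅y⁆⇒x≡y v w∈v)
    exits : ∀ {T} → ExitsOnlyAt T W v
    exits {e = e} {x} _ (x∈W , z , j , z∉W) with x ≟ v | x∈p∪q⁻ reach ⁅ v ⁆ x∈W
    ... | yes x≡v | _            = x≡v
    ... | no x≢v  | inj₂ x∈v     = contradiction (x∈⁅y⁆⇒x≡y v x∈v) x≢v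
    ... | no x≢v  | inj₁ x∈reach with e ∈? incident G v
    ...   | no e∉v = contradiction (x∈p∪q⁺ (inj₁ (reach-closed x∈reach (x∉p⇒x∈∁p e∉v) j))) z∉W
    ...   | yes e∈v with incident⇒end e∈v j
    ...     | inj₁ v≡x = contradiction (sym v≡x) x≢v
    ...     | inj₂ v≡z = contradiction (subst (_∈ W) v≡z v∈W) z∉W

  edge-connectivity-2⇒composite : Bispanning G → 3 ≤ n → EdgeConnectivity G 2 → Composite G
  edge-connectivity-2⇒composite B 3≤n ((S , ∣S∣≡2 , u , w , no-walk) , _) = side (2 ≤? ∣ reach ∣)
    where
    open Reachable (∁ S) u
    w∉reach : w ∉ reach
    w∉reach w∈reach = no-walk (reach-sound w∈reach)
    cut : ∀ {e x} → Leaves e reach x → e ∈ S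
    cut {e} (x∈reach , _ , j , z∉reach) with e ∈? S
    ... | yes e∈S = e∈S
    ... | no e∉S  = contradiction (reach-closed x∈reach (x∉p⇒x∈∁p e∉S) j) z∉reach
    side : Dec (2 ≤ ∣ reach ∣) → Composite G
    side (yes large) = two-edge-cut⇒composite B ∣S∣≡2 cut u∈reach w∉reach large
    side (no small)  =
      two-edge-cut⇒composite B ∣S∣≡2 (cut ∘ proj₂ ∘ leaves-∁) (x∉p⇒x∈∁p w∉reach) (x∈p⇒x∉∁p u∈reach)
        (subst (2 ≤_) (sym (∣∁p∣≡n∸∣p∣ reach)) (∸-mono 3≤n (≤-pred (≰⇒> small))))

  degree-2⇒composite : Bispanning G → 3 ≤ n → ∃ (λ v → degree G v ≡ 2) → Composite G
  degree-2⇒composite B 3≤n (v , degree≡2) = two-edge-cut⇒composite B degree≡2 cut (proj₂ nonempty) v∉W 2≤∣W∣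
    where
    W = ∁ ⁅ v ⁆
    v∉W : v ∉ W
    v∉W = x∈p⇒x∉∁p (x∈⁅x⁆ v)
    2≤∣W∣ : 2 ≤ ∣ W ∣
    2≤∣W∣ = subst (2 ≤_) (sym (trans (∣∁p∣≡n∸∣p∣ ⁅ v ⁆) (cong (n ∸_) (∣⁅x⁆∣≡1 v)))) (∸-mono 3≤n (≤-refl {1}))
    nonempty : Nonempty W
    nonempty = 0<∣p∣⇒Nonempty W (<-trans (s≤s z≤n) 2≤∣W∣)
    cut : ∀ {e x} → Leaves e W x → e ∈ incident G v
    cut (_ , z , j , z∉W) = subst (λ y → _ ∈ incident G y) (x∈⁅y⁆⇒x≡y v (x∉∁p⇒x∈p z∉W)) (joins⇒incident j)

mainTheorem8 : (G : Graph) → Bispanning G → 3 ≤ Graph.n G →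
    (HasParallelEdges G → Composite G)
    × (Atomic G → Simple G)
    × (HasCutVertex G → Composite G)
    × (EdgeConnectivity G 2 → Composite G)
    × (∃ (λ v → degree G v ≡ 2) → Composite G)
mainTheorem8 G B 3≤n =
    parallel-edges⇒composite G B 3≤n
  , (λ (_ , ¬composite) parallel → ¬composite (parallel-edges⇒composite G B 3≤n parallel))
  , cut-vertex⇒composite G B
  , edge-connectivity-2⇒composite G B 3≤n
  , degree-2⇒composite G B 3≤n
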